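{- For integers $1 \le n \le m$, $Z_{(1)}(P_n \Box P_m) \le 2n$, where $P_n\Box P_m$ is the Cartesian product of the paths on $n$ and $m$ vertices.
   Context: Let $G=(V,E)$ be a finite simple graph. Color-change rule (zero forcing): given a set of colored vertices, a colored vertex with exactly one uncolored neighbor colors ("forces") that neighbor. Leaks: for a set $L\subseteq V$, placing a leak on each $v\in L$ means attaching to $v$ one new pendant vertex (adjacent only to $v$) which is never initially colored; consequently no vertex of $L$ can ever force a vertex of $V$. A set $S\subseteq V$ is an $\ell$-forcing set if for every $L\subseteq V$ with $|L|\le \ell$, starting with exactly the vertices of $S$ colored and repeatedly applying the color-change rule in the graph with leaks on $L$, every vertex of $V$ eventually becomes colored. $Z_{(\ell)}(G)$ is the minimum size of an $\ell$-forcing set. The Cartesian product $G\Box H$ has vertex set $V(G)\times V(H)$, with $(x,y)\sim(x',y')$ iff ($x=x'$ and $y\sim y'$ in $H$) or ($y=y'$ and $x\sim x'$ in $G$). -}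

module Defs where

open import Data.Nat using (ℕ; suc; _≤_)
open import Data.Fin using (Fin; toℕ)
open import Data.List using (List; length)
open import Data.List.Membership.Propositional using (_∈_)
open import Data.Product using (Σ; _×_; _,_)
open import Data.Sum using (_⊎_; inj₁; inj₂)
open import Data.Empty using (⊥)
open import Relation.Binary.PropositionalEquality using (_≡_; _≢_)
open import Level using (0ℓ)

record Graph : Set₁ where
  field
    V   : Set
    _~_ : V → V → Set
open Graph public

P : ℕ → Graph
P n = record { V = Fin n ; _~_ = λ i j → (toℕ j ≡ suc (toℕ i)) ⊎ (toℕ i ≡ suc (toℕ j)) }

_□_ : Graph → Graph → Graph
G □ H = record
  { V = V G × V H
  ; _~_ = λ { (x , y) (x' , y') → ((x ≡ x') × (_~_ H y y')) ⊎ ((y ≡ y') × (_~_ G x x')) } }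

-- Graph with leaks on L: one new pendant vertex (v , p) attached to each v ∈ L.
leak : (G : Graph) → List (V G) → Graph
leak G L = record { V = V G ⊎ Σ (V G) (λ v → v ∈ L) ; _~_ = adj }
  where
  adj : V G ⊎ Σ (V G) (λ v → v ∈ L) → V G ⊎ Σ (V G) (λ v → v ∈ L) → Set
  adj (inj₁ a) (inj₁ b) = _~_ G a b
  adj (inj₁ a) (inj₂ (b , _)) = a ≡ b
  adj (inj₂ (a , _)) (inj₁ b) = a ≡ b
  adj (inj₂ _) (inj₂ _) = ⊥

-- Vertices eventually colored from the initially colored set S under the
-- color-change rule: a colored u all of whose neighbours other than v are
-- colored (so v is its unique possibly-uncolored neighbour) forces v.
data Colored (G : Graph) (S : V G → Set) : V G → Set where
  init  : ∀ {v} → S v → Colored G S v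
  force : ∀ {u v} → Colored G S u → _~_ G u v
        → (∀ w → _~_ G u w → w ≢ v → Colored G S w)
        → Colored G S v

initLeak : (G : Graph) (L : List (V G)) → List (V G) → V (leak G L) → Set
initLeak G L S (inj₁ v) = v ∈ S
initLeak G L S (inj₂ _) = ⊥

IsLeakyForcingSet : ℕ → (G : Graph) → List (V G) → Set
IsLeakyForcingSet ℓ G S =
  (L : List (V G)) → length L ≤ ℓ → (v : V G) → Colored (leak G L) (initLeak G L S) (inj₁ v)

-- Colour the first and the last column of G □ P_m; a single leak sits in some
-- column c. Once columns 0,…,t are coloured with t < c, each vertex of column t
-- has a single uncoloured neighbour, its copy in column t+1, and no leak, so it
-- forces that copy; sweeping from the first column thus colours every column
-- j ≤ c. The columns j > c are swept in the same way from the last column,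
-- which is the first sweep read through the reflection of the path.
module Submission where

open import Defs
open import Data.Nat using (ℕ; zero; suc; _≤_; _<_; _*_; _+_; _∸_; s≤s)
open import Data.Nat.Properties
open import Data.Fin using (Fin; toℕ; fromℕ<; opposite)
open import Data.Fin.Properties using (toℕ-injective; toℕ-fromℕ<; toℕ<n; opposite-prop; opposite-involutive)
open import Data.List using (List; []; _∷_; length; map; _++_; allFin)
open import Data.List.Properties using (length-++; length-map; length-tabulate)
open import Data.List.Membership.Propositional using (_∈_)
open import Data.List.Membership.Propositional.Properties using (∈-map⁺; ∈-++⁺ˡ; ∈-++⁺ʳ; ∈-allFin)
open import Data.List.Relation.Unary.Any using (here)
open import Data.Product using (Σ; _×_; _,_; proj₂)
open import Data.Sum using (_⊎_; inj₁; inj₂)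
open import Data.Empty using (⊥-elim)
open import Function using (_∘_; id)
open import Relation.Nullary using (yes; no)
open import Relation.Binary.PropositionalEquality

-- f measures the distance from an end of the path; its level-0 columns are the
-- sources of a sweep.
record Grading (m : ℕ) (f : Fin m → ℕ) : Set where
  field
    injective : ∀ {a b} → f a ≡ f b → a ≡ b
    steps     : ∀ {a b} → _~_ (P m) a b → (f b ≡ suc (f a)) ⊎ (f a ≡ suc (f b))
    descends  : ∀ j t → f j ≡ suc t → Σ (Fin m) λ j′ → (f j′ ≡ t) × _~_ (P m) j′ j

toℕ-grading : ∀ m → Grading m toℕ
toℕ-grading m = record { injective = toℕ-injective ; steps = id ; descends = descends }
  where
  descends : ∀ j t → toℕ j ≡ suc t → Σ (Fin m) λ j′ → (toℕ j′ ≡ t) × _~_ (P m) j′ j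
  descends j t j≡1+t = fromℕ< t<m , toℕ-fromℕ< t<m , inj₁ (trans j≡1+t (cong suc (sym (toℕ-fromℕ< t<m))))
    where
    t<m : t < m
    t<m = <-trans (n<1+n t) (subst (_< m) j≡1+t (toℕ<n j))

grading-∘-automorphism : ∀ {m f} (σ : Fin m → Fin m) → (∀ a → σ (σ a) ≡ a) →
  (∀ {a b} → _~_ (P m) a b → _~_ (P m) (σ a) (σ b)) → Grading m f → Grading m (f ∘ σ)
grading-∘-automorphism {m} {f} σ σσ σ-adj grading = record
  { injective = λ e → trans (sym (σσ _)) (trans (cong σ (injective e)) (σσ _))
  ; steps     = steps ∘ σ-adj
  ; descends  = descends′
  }
  where
  open Grading grading
  descends′ : ∀ j t → f (σ j) ≡ suc t → Σ (Fin m) λ j′ → (f (σ j′) ≡ t) × _~_ (P m) j′ j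
  descends′ j t e with descends (σ j) t e
  ... | j′ , fj′≡t , j′~σj =
    σ j′ , trans (cong f (σσ j′)) fj′≡t , subst (_~_ (P m) (σ j′)) (σσ j) (σ-adj j′~σj)

opposite-step : ∀ {m} {a b : Fin m} → toℕ b ≡ suc (toℕ a) → toℕ (opposite a) ≡ suc (toℕ (opposite b))
opposite-step {m} {a} {b} b≡1+a = begin
  toℕ (opposite a)     ≡⟨ opposite-prop a ⟩
  m ∸ suc (toℕ a)      ≡⟨ cong (m ∸_) (sym b≡1+a) ⟩
  m ∸ toℕ b            ≡⟨ +-∸-assoc 1 (toℕ<n b) ⟩
  suc (m ∸ suc (toℕ b)) ≡⟨ cong suc (sym (opposite-prop b)) ⟩
  suc (toℕ (opposite b)) ∎
  where open ≡-Reasoning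

opposite-adjacent : ∀ {m} {a b : Fin m} → _~_ (P m) a b → _~_ (P m) (opposite a) (opposite b)
opposite-adjacent (inj₁ b≡1+a) = inj₂ (opposite-step b≡1+a)
opposite-adjacent (inj₂ a≡1+b) = inj₁ (opposite-step a≡1+b)

opposite-grading : ∀ m → Grading m (toℕ ∘ opposite)
opposite-grading m = grading-∘-automorphism opposite opposite-involutive opposite-adjacent (toℕ-grading m)

module Sweep {G : Graph} {m : ℕ} {f : Fin m → ℕ} (grading : Grading m f)
  {S L : List (V (G □ P m))} (sources : ∀ x j → f j ≡ 0 → (x , j) ∈ S)
  {k : ℕ} (leaks-beyond : ∀ v → v ∈ L → k ≤ f (proj₂ v)) where

  open Grading grading

  Reached : V (G □ P m) → Set
  Reached v = Colored (leak (G □ P m) L) (initLeak (G □ P m) L S) (inj₁ v)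

  reached-upto : ∀ t → t ≤ k → ∀ x j → f j ≤ t → Reached (x , j)
  reached-upto zero _ x j fj≤0 = init (sources x j (n≤0⇒n≡0 fj≤0))
  reached-upto (suc t) 1+t≤k x j fj≤1+t with f j ≤? t
  ... | yes fj≤t = reached-upto t (<⇒≤ 1+t≤k) x j fj≤t
  ... | no fj≰t = forced (descends j t fj≡1+t)
    where
    fj≡1+t : f j ≡ suc t
    fj≡1+t = ≤-antisym fj≤1+t (≰⇒> fj≰t)

    previous : ∀ x j → f j ≤ t → Reached (x , j)
    previous = reached-upto t (<⇒≤ 1+t≤k)

    forced : Σ (Fin m) (λ j′ → (f j′ ≡ t) × _~_ (P m) j′ j) → Reached (x , j)
    forced (j′ , fj′≡t , j′~j) = force (previous x j′ (≤-reflexive fj′≡t)) (inj₁ (refl , j′~j)) others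
      where
      others : ∀ w → _~_ (leak (G □ P m) L) (inj₁ (x , j′)) w → w ≢ inj₁ (x , j) →
        Colored (leak (G □ P m) L) (initLeak (G □ P m) L S) w
      others (inj₂ (v , v∈L)) refl _ = ⊥-elim (<⇒≱ 1+t≤k (subst (k ≤_) fj′≡t (leaks-beyond v v∈L)))
      others (inj₁ (x′ , j′)) (inj₂ (refl , _)) _ = previous x′ j′ (≤-reflexive fj′≡t)
      others (inj₁ (x , y)) (inj₁ (refl , j′~y)) w≢xj with steps j′~y
      -- by injectivity of f, the neighbour of j′ one level up is j itself
      ... | inj₁ fy≡1+fj′ = ⊥-elim (w≢xj (cong (λ z → inj₁ (x , z))
                              (injective (trans fy≡1+fj′ (trans (cong suc fj′≡t) (sym fj≡1+t))))))
      ... | inj₂ fj′≡1+fy = previous x y (≤-trans (n≤1+n _) (≤-reflexive (trans (sym fj′≡1+fy) fj′≡t)))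

  reached : ∀ x j → f j ≤ k → Reached (x , j)
  reached = reached-upto k ≤-refl

module _ {A : Set} {m : ℕ} (0<m : 0 < m) where

  first last : Fin m
  first = fromℕ< 0<m
  last  = opposite first

  column : List A → Fin m → List (A × Fin m)
  column xs j = map (_, j) xs

  end-columns : List A → List (A × Fin m)
  end-columns xs = column xs first ++ column xs last

  length-end-columns : ∀ xs → length (end-columns xs) ≡ 2 * length xs
  length-end-columns xs = begin
    length (column xs first ++ column xs last)         ≡⟨ length-++ (column xs first) ⟩
    length (column xs first) + length (column xs last) ≡⟨ cong₂ _+_ (length-map _ xs) (length-map _ xs) ⟩
    length xs + length xs                              ≡⟨ cong (length xs +_) (sym (+-identityʳ (length xs))) ⟩
    2 * length xs                                      ∎
    where open ≡-Reasoning

  module _ {xs : List A} (complete : ∀ x → x ∈ xs) where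

    ∈-end-columnsˡ : ∀ x j → toℕ j ≡ 0 → (x , j) ∈ end-columns xs
    ∈-end-columnsˡ x j j≡0 with toℕ-injective {i = j} {j = first} (trans j≡0 (sym (toℕ-fromℕ< 0<m)))
    ... | refl = ∈-++⁺ˡ (∈-map⁺ (_, first) (complete x))

    ∈-end-columnsʳ : ∀ x j → toℕ (opposite j) ≡ 0 → (x , j) ∈ end-columns xs
    ∈-end-columnsʳ x j oj≡0 = subst (λ j → (x , j) ∈ end-columns xs) (sym j≡last)
      (∈-++⁺ʳ (column xs first) (∈-map⁺ (_, last) (complete x)))
      where
      j≡last : j ≡ last
      j≡last = trans (sym (opposite-involutive j))
        (cong opposite (toℕ-injective (trans oj≡0 (sym (toℕ-fromℕ< 0<m)))))

sole-leak : ∀ {A : Set} {ℓ : A} (g : A → ℕ) → ∀ v → v ∈ ℓ ∷ [] → g ℓ ≤ g v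
sole-leak g v (here refl) = ≤-refl

end-columns-1-forcing : ∀ (G : Graph) {m} (0<m : 0 < m) {xs : List (V G)} → (∀ x → x ∈ xs) →
  IsLeakyForcingSet 1 (G □ P m) (end-columns 0<m xs)
end-columns-1-forcing G {m} 0<m complete [] _ (x , j) =
  Sweep.reached (toℕ-grading m) (∈-end-columnsˡ 0<m complete) {k = toℕ j} (λ _ ()) x j ≤-refl
end-columns-1-forcing G {m} 0<m complete (ℓ ∷ []) _ (x , j) with toℕ j ≤? toℕ (proj₂ ℓ)
... | yes j≤c = Sweep.reached (toℕ-grading m) (∈-end-columnsˡ 0<m complete)
                  (sole-leak (toℕ ∘ proj₂)) x j j≤c
... | no j≰c  = Sweep.reached (opposite-grading m) (∈-end-columnsʳ 0<m complete)
                  (sole-leak (toℕ ∘ opposite ∘ proj₂)) x j oj≤oc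
  where
  oj≤oc : toℕ (opposite j) ≤ toℕ (opposite (proj₂ ℓ))
  oj≤oc = subst₂ _≤_ (sym (opposite-prop j)) (sym (opposite-prop (proj₂ ℓ)))
            (∸-monoʳ-≤ m (s≤s (<⇒≤ (≰⇒> j≰c))))
end-columns-1-forcing G 0<m complete (_ ∷ _ ∷ _) (s≤s ())

proposition26 : (n m : ℕ) → 1 ≤ n → n ≤ m →
    Σ _ (λ S → (length S ≤ 2 * n) × IsLeakyForcingSet 1 (P n □ P m) S)
proposition26 n m 1≤n n≤m =
  end-columns 0<m (allFin n) , ≤-reflexive length≡2n , end-columns-1-forcing (P n) 0<m ∈-allFin
  where
  0<m : 0 < m
  0<m = ≤-trans 1≤n n≤m
  length≡2n : length (end-columns 0<m (allFin n)) ≡ 2 * n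
  length≡2n = trans (length-end-columns 0<m (allFin n)) (cong (2 *_) (length-tabulate {n = n} (λ i → i)))
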